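{- Let $n,m$ be positive integers. Write $n=am+b$ with integers $a>0$ and $0<b<m$, and set $d=a+b$ and $k=\lfloor n/d\rfloor$. Let $\Delta$ be the regular configuration in $\mathrm{CONF}(a,b)$, and fix a reading of $\Delta$ as in the context. Then the cycles $C_{0,\Delta}, C_{m-1,\Delta}, C_{2(m-1),\Delta},\dots,C_{(k-1)(m-1),\Delta}$ in $\mathrm{Shift}(n,m)$ are pairwise vertex-disjoint.
   Context: $\mathrm{Shift}(n,m)$ is the directed graph with vertex set $\mathbb{Z}_n=\{0,\dots,n-1\}$ and arcs $i\to i+1$ and $i\to i+m$ (mod $n$). $\mathrm{CONF}(a,b)$ is the set of necklaces (circular arrangements up to rotation) of $a$ red and $b$ black beads. For a necklace with black beads $B_0,\dots,B_{b-1}$ in cyclic order, its characteristic sequence $\{x_0,\dots,x_{b-1}\}$ lists the number $x_i$ of red beads between $B_i$ and $B_{i+1}$. The necklace is regular if $\frac{a}{b}k'-1<x_i+\dots+x_{i+k'-1}<\frac{a}{b}k'+1$ for all $0\le i\le b-1$ and $1\le k'\le 1+\lfloor b/2\rfloor$ (indices mod $b$). There is a unique regular configuration in $\mathrm{CONF}(a,b)$. Fix a reading of $\Delta$: the beads $\beta_0,\dots,\beta_{d-1}$ encountered in cyclic order starting from some bead. Set $l_p=m$ if $\beta_p$ is red and $l_p=1$ if $\beta_p$ is black, so that $l_0+\dots+l_{d-1}=am+b=n$. For $v\in\mathbb{Z}_n$, $C_{v,\Delta}$ is the directed cycle of $\mathrm{Shift}(n,m)$ with vertex sequence $v,\ v+l_0,\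 v+l_0+l_1,\ \dots,\ v+l_0+\dots+l_{d-2}$ (mod $n$). The same reading is used for all $v$. -}

module Defs where

open import Data.Nat using (ℕ; zero; suc; _+_; _*_; _∸_; _<_; _≤_)
open import Data.Nat.DivMod using (_/_; _%_)
open import Data.List using (List; []; _∷_; length; take; map)
open import Data.Nat.ListAction using (sum)
open import Data.Product using (_×_)

data Bead : Set where
  red black : Bead

-- Total versions of floor division and remainder (divisor 0 gives 0;
-- every use below has a provably positive divisor).
_div′_ : ℕ → ℕ → ℕ
n div′ zero  = zero
n div′ suc d = n / suc d

_mod′_ : ℕ → ℕ → ℕ
n mod′ zero  = zero
n mod′ suc d = n % suc d

countRed : List Bead → ℕ
countRed []            = 0
countRed (red   ∷ w) = suc (countRed w)
countRed (black ∷ w) = countRed w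

-- Lengths of the maximal red runs separated by black beads:
-- w = r^{c0} B r^{c1} B ... B r^{cb}  ↦  c0 ∷ c1 ∷ ... ∷ cb
segments : List Bead → List ℕ
segments []            = 0 ∷ []
segments (red   ∷ w) with segments w
... | []     = 1 ∷ []
... | c ∷ cs = suc c ∷ cs
segments (black ∷ w) = 0 ∷ segments w

addLast : ℕ → List ℕ → List ℕ
addLast x []           = []
addLast x (y ∷ [])     = (y + x) ∷ []
addLast x (y ∷ z ∷ ys) = y ∷ addLast x (z ∷ ys)

-- Characteristic sequence of the necklace read (cyclically) by the word w,
-- starting from the first black bead B_0 of w:
-- x_i = number of red beads between B_i and B_{i+1} (cyclically),
-- i.e.  c1 , c2 , ... , c_{b-1} , c_b + c0.
charSeq : List Bead → List ℕ
charSeq w with segments w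
... | []      = []
... | c0 ∷ cs = addLast c0 cs

lookupℕ : List ℕ → ℕ → ℕ
lookupℕ []       i       = 0
lookupℕ (x ∷ xs) zero    = x
lookupℕ (x ∷ xs) (suc i) = lookupℕ xs i

xAt : List Bead → ℕ → ℕ → ℕ
xAt w b i = lookupℕ (charSeq w) (i mod′ b)

blockSum : List Bead → ℕ → ℕ → ℕ → ℕ
blockSum w b i zero     = 0
blockSum w b i (suc k') = xAt w b i + blockSum w b (suc i) k'

-- Regularity of the necklace read by w (a red, b black beads):
-- a/b·k' − 1 < S < a/b·k' + 1, multiplied through by b > 0:
-- a·k' − b < b·S < a·k' + b.
Regular : ℕ → ℕ → List Bead → Set
Regular a b w = ∀ i k' → i < b → 1 ≤ k' → k' ≤ 1 + (b div′ 2) →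
  (a * k' < b * blockSum w b i k' + b) × (b * blockSum w b i k' < a * k' + b)

beadLen : ℕ → Bead → ℕ
beadLen m red   = m
beadLen m black = 1

prefixLen : ℕ → List Bead → ℕ → ℕ
prefixLen m w t = sum (map (beadLen m) (take t w))

cycleVertex : ℕ → ℕ → List Bead → ℕ → ℕ → ℕ
cycleVertex n m w v t = (v + prefixLen m w t) mod′ n

module Submission where

-- Write m = μ + 1 and d = a + b.  A prefix of the reading with β black and R
-- red beads ends at vertex v + β + m·R (mod n) of C_{v,Δ}.  Multiplying by a
-- and using a·m ≡ −b (mod n), vertex t of C_{jμ,Δ} becomes −(j·d + b·R − a·β).
-- Hence a common vertex of C_{j₁μ,Δ} and C_{j₂μ,Δ} makes
-- (j₂ − j₁)·d + (difference of the weights b·R − a·β of two prefixes)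
-- a multiple of n.  The heart of the proof is a discrepancy estimate: for the
-- regular necklace the weights of any two prefixes differ by less than d.
-- Regularity bounds |b·(block sum) − a·(block length)| by b for blocks of
-- length ≤ 1 + ⌊b/2⌋; passing to complements extends this to all blocks of
-- length ≤ b, and comparing prefixes with the red runs of the word yields the
-- estimate.  As 0 < j₂ − j₁ and (j₂ + 1)·d ≤ n, the multiple of n would lie
-- strictly between 0 and n.

open import Defs
open import Data.Nat
open import Data.Nat.Properties
open import Data.Nat.DivMod
open import Data.List using (List; []; _∷_; length; take; map)
open import Data.Nat.ListAction using (sum)
open import Data.Product using (Σ; _×_; _,_; proj₁; proj₂; swap)
open import Data.Empty using (⊥; ⊥-elim)
open import Data.Sum using (_⊎_; inj₁; inj₂)
open import Relation.Nullary using (yes; no)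
open import Relation.Binary.PropositionalEquality
open import Data.Nat.Tactic.RingSolver using (solve-∀)

-- `Near r x y`: the natural numbers x and y differ by less than r.
-- Regularity says b·(block sum) is Near b to a·(block length).
Near : ℕ → ℕ → ℕ → Set
Near r x y = x < y + r × y < x + r

Near-sym : ∀ {r x y} → Near r x y → Near r y x
Near-sym = swap

Near-zero : ∀ {r} a b → 0 < r → Near r (a * 0) (b * 0)
Near-zero {r} a b 0<r rewrite *-zeroʳ a | *-zeroʳ b = 0<r , 0<r

Near-shift : ∀ {r x y} z → Near r x y → Near r (z + x) (z + y)
Near-shift {r} z (x<y+r , y<x+r) = shift x<y+r , shift y<x+r
  where
  shift : ∀ {u v} → u < v + r → z + u < z + v + r
  shift {u} {v} h = subst (z + u <_) (sym (+-assoc z v r)) (+-monoʳ-< z h)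

Near-complement : ∀ {r x y x′ y′} → x + x′ ≡ y + y′ → Near r x y → Near r x′ y′
Near-complement {r} e (x<y+r , y<x+r) = remainder e y<x+r , remainder (sym e) x<y+r
  where
  open ≤-Reasoning
  remainder : ∀ {u v u′ v′} → u + u′ ≡ v + v′ → v < u + r → u′ < v′ + r
  remainder {u} {v} {u′} {v′} e v<u+r = +-cancelˡ-< v u′ (v′ + r) (begin-strict
    v + u′      <⟨ +-monoˡ-< u′ v<u+r ⟩
    u + r + u′  ≡⟨ +-assoc u r u′ ⟩
    u + (r + u′) ≡⟨ cong (u +_) (+-comm r u′) ⟩
    u + (u′ + r) ≡⟨ sym (+-assoc u u′ r) ⟩
    u + u′ + r  ≡⟨ cong (_+ r) e ⟩
    v + v′ + r  ≡⟨ +-assoc v v′ r ⟩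
    v + (v′ + r) ∎)

window : ∀ n x y G₀ G₁ → y < x → x < y + n → x + n * G₀ ≡ n * G₁ + y → ⊥
window n x y G₀ G₁ y<x x<y+n eq with G₁ ≤? G₀
... | yes G₁≤G₀ = <-irrefl (sym eq) (begin-strict
  n * G₁ + y  <⟨ +-monoʳ-< (n * G₁) y<x ⟩
  n * G₁ + x  ≤⟨ +-monoˡ-≤ x (*-monoʳ-≤ n G₁≤G₀) ⟩
  n * G₀ + x  ≡⟨ +-comm (n * G₀) x ⟩
  x + n * G₀  ∎)
  where open ≤-Reasoning
... | no G₁≰G₀ = <-irrefl eq (begin-strict
  x + n * G₀        <⟨ +-monoˡ-< (n * G₀) x<y+n ⟩
  y + n + n * G₀    ≡⟨ regroup y n G₀ ⟩
  n * suc G₀ + y    ≤⟨ +-monoˡ-≤ y (*-monoʳ-≤ n (≰⇒> G₁≰G₀)) ⟩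
  n * G₁ + y        ∎)
  where
  open ≤-Reasoning
  regroup : ∀ y n G → y + n + n * G ≡ n * suc G + y
  regroup = solve-∀

shiftedWeights : ∀ {d N j₁ j₂ P Q} → Near d P Q → j₁ < j₂ → suc j₂ * d ≤ N →
  P + j₁ * d < j₂ * d + Q × j₂ * d + Q < P + j₁ * d + N
shiftedWeights {d} {N} {j₁} {j₂} {P} {Q} (P<Q+d , Q<P+d) j₁<j₂ fits = low , high
  where
  open ≤-Reasoning
  low : P + j₁ * d < j₂ * d + Q
  low = begin-strict
    P + j₁ * d      <⟨ +-monoˡ-< (j₁ * d) P<Q+d ⟩
    Q + d + j₁ * d  ≡⟨ +-assoc Q d (j₁ * d) ⟩
    Q + suc j₁ * d  ≤⟨ +-monoʳ-≤ Q (*-monoˡ-≤ d j₁<j₂) ⟩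
    Q + j₂ * d      ≡⟨ +-comm Q (j₂ * d) ⟩
    j₂ * d + Q      ∎
  high : j₂ * d + Q < P + j₁ * d + N
  high = begin-strict
    j₂ * d + Q          <⟨ +-monoʳ-< (j₂ * d) Q<P+d ⟩
    j₂ * d + (P + d)    ≡⟨ regroup j₂ d P ⟩
    P + suc j₂ * d      ≤⟨ +-monoʳ-≤ P fits ⟩
    P + N               ≤⟨ +-monoˡ-≤ N (m≤m+n P (j₁ * d)) ⟩
    P + j₁ * d + N      ∎
    where
    regroup : ∀ j d P → j * d + (P + d) ≡ P + suc j * d
    regroup = solve-∀

sameResidue : ∀ x y n .{{_ : NonZero n}} → x % n ≡ y % n → x + (y / n) * n ≡ y + (x / n) * n
sameResidue x y n e = begin
  x + y / n * n                   ≡⟨ cong (_+ y / n * n) (m≡m%n+[m/n]*n x n) ⟩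
  x % n + x / n * n + y / n * n   ≡⟨ cong (λ r → r + x / n * n + y / n * n) e ⟩
  y % n + x / n * n + y / n * n   ≡⟨ +-assoc (y % n) _ _ ⟩
  y % n + (x / n * n + y / n * n) ≡⟨ cong (y % n +_) (+-comm (x / n * n) _) ⟩
  y % n + (y / n * n + x / n * n) ≡⟨ sym (+-assoc (y % n) _ _) ⟩
  y % n + y / n * n + x / n * n   ≡⟨ cong (_+ x / n * n) (sym (m≡m%n+[m/n]*n y n)) ⟩
  y + x / n * n                   ∎
  where open ≡-Reasoning

-- Multiplying the congruence  j₁μ + β₁ + mR₁ ≡ j₂μ + β₂ + mR₂ (mod n)  by a,
-- where m = μ + 1 and n = am + b, and using am ≡ −b and aμ ≡ −d (d = a + b):
-- the congruence becomes one between the weights  j·d + (b·R − a·β).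
scaledCongruence : ∀ μ a b j₁ j₂ β₁ β₂ R₁ R₂ q₁ q₂ →
  j₁ * μ + (β₁ + suc μ * R₁) + q₂ * (a * suc μ + b) ≡
    j₂ * μ + (β₂ + suc μ * R₂) + q₁ * (a * suc μ + b) →
  j₂ * (a + b) + (b * R₂ + a * β₁) + (a * suc μ + b) * (j₁ + R₁ + q₂ * a) ≡
    (a * suc μ + b) * (j₂ + R₂ + q₁ * a) + (b * R₁ + a * β₂ + j₁ * (a + b))
scaledCongruence μ a b j₁ j₂ β₁ β₂ R₁ R₂ q₁ q₂ e =
  +-cancelʳ-≡ (a * (j₂ * μ + (β₂ + suc μ * R₂) + q₁ * (a * suc μ + b))) _ _
    (trans (expand j₁ j₂ β₁ β₂ R₁ R₂ q₁ q₂ μ a b)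
           (cong (λ z → (a * suc μ + b) * (j₂ + R₂ + q₁ * a) + (b * R₁ + a * β₂ + j₁ * (a + b)) + a * z) e))
  where
  expand : ∀ j₁ j₂ β₁ β₂ R₁ R₂ q₁ q₂ μ a b →
    j₂ * (a + b) + (b * R₂ + a * β₁) + (a * suc μ + b) * (j₁ + R₁ + q₂ * a)
      + a * (j₂ * μ + (β₂ + suc μ * R₂) + q₁ * (a * suc μ + b))
    ≡ (a * suc μ + b) * (j₂ + R₂ + q₁ * a) + (b * R₁ + a * β₂ + j₁ * (a + b))
      + a * (j₁ * μ + (β₁ + suc μ * R₁) + q₂ * (a * suc μ + b))
  expand = solve-∀

prefixSum : (ℕ → ℕ) → ℕ → ℕ
prefixSum f zero    = 0
prefixSum f (suc k) = f 0 + prefixSum (λ i → f (suc i)) k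

prefixSum-snoc : ∀ f k → prefixSum f (suc k) ≡ prefixSum f k + f k
prefixSum-snoc f zero    = +-comm (f 0) 0
prefixSum-snoc f (suc k) =
  trans (cong (f 0 +_) (prefixSum-snoc (λ i → f (suc i)) k)) (sym (+-assoc (f 0) _ _))

prefixSum-cong : ∀ f g k → (∀ i → i < k → f i ≡ g i) → prefixSum f k ≡ prefixSum g k
prefixSum-cong f g zero    _  = refl
prefixSum-cong f g (suc k) eq = cong₂ _+_ (eq 0 z<s)
  (prefixSum-cong (λ i → f (suc i)) (λ i → g (suc i)) k (λ i i<k → eq (suc i) (s<s i<k)))

prefixSum-mono : ∀ f g k → (∀ i → f i ≤ g i) → prefixSum f k ≤ prefixSum g k
prefixSum-mono f g zero    _  = z≤n
prefixSum-mono f g (suc k) le =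
  +-mono-≤ (le 0) (prefixSum-mono (λ i → f (suc i)) (λ i → g (suc i)) k (λ i → le (suc i)))

prefixSum-monoʳ : ∀ f {k l} → k ≤ l → prefixSum f k ≤ prefixSum f l
prefixSum-monoʳ f {zero}          _         = z≤n
prefixSum-monoʳ f {suc k} {suc l} (s≤s k≤l) = +-monoʳ-≤ (f 0) (prefixSum-monoʳ (λ i → f (suc i)) k≤l)

prefixSum-lookup : ∀ xs → prefixSum (lookupℕ xs) (length xs) ≡ sum xs
prefixSum-lookup []       = refl
prefixSum-lookup (x ∷ xs) = cong (x +_) (prefixSum-lookup xs)

countBlack : List Bead → ℕ
countBlack []            = 0
countBlack (red   ∷ w) = countBlack w
countBlack (black ∷ w) = suc (countBlack w)

length-colours : ∀ w → length w ≡ countRed w + countBlack w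
length-colours []          = refl
length-colours (red   ∷ w) = cong suc (length-colours w)
length-colours (black ∷ w) = trans (cong suc (length-colours w)) (sym (+-suc _ _))

countBlack-take : ∀ t w → countBlack (take t w) ≤ countBlack w
countBlack-take zero    w           = z≤n
countBlack-take (suc t) []          = z≤n
countBlack-take (suc t) (red   ∷ w) = countBlack-take t w
countBlack-take (suc t) (black ∷ w) = s≤s (countBlack-take t w)

prefixLen-colours : ∀ m u → sum (map (beadLen m) u) ≡ countBlack u + m * countRed u
prefixLen-colours m []          = sym (*-zeroʳ m)
prefixLen-colours m (red   ∷ u) =
  trans (cong (m +_) (prefixLen-colours m u)) (regroup m (countBlack u) (countRed u))
  where
  regroup : ∀ m x y → m + (x + m * y) ≡ x + m * suc y
  regroup = solve-∀
prefixLen-colours m (black ∷ u) = cong suc (prefixLen-colours m u)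

segments-shape : ∀ w → Σ ℕ λ c₀ → Σ (List ℕ) λ cs → segments w ≡ c₀ ∷ cs × length cs ≡ countBlack w
segments-shape [] = 0 , [] , refl , refl
segments-shape (red ∷ w) with segments w | segments-shape w
... | .(c₀ ∷ cs) | c₀ , cs , refl , len = suc c₀ , cs , refl , len
segments-shape (black ∷ w) with segments-shape w
... | c₀ , cs , eq , len = 0 , c₀ ∷ cs , cong (0 ∷_) eq , cong suc len

segments-sum : ∀ w → sum (segments w) ≡ countRed w
segments-sum []          = refl
segments-sum (red ∷ w) with segments w | segments-sum w
... | []     | e = cong suc e
... | c ∷ cs | e = cong suc e
segments-sum (black ∷ w) = segments-sum w

prefixReds : ∀ w t → Σ ℕ λ ρ →
  ρ ≤ lookupℕ (segments w) (countBlack (take t w)) ×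
  countRed (take t w) ≡ prefixSum (lookupℕ (segments w)) (countBlack (take t w)) + ρ
prefixReds w           zero    = 0 , z≤n , refl
prefixReds []          (suc t) = 0 , z≤n , refl
prefixReds (black ∷ w) (suc t) = prefixReds w t
prefixReds (red ∷ w)   (suc t) with segments w | countBlack (take t w) | prefixReds w t
... | []     | zero  | ρ , z≤n , e = 1 , ≤-refl , cong suc e
... | []     | suc β | ρ , ρ≤  , e = ρ , ρ≤ , cong suc e
... | c ∷ cs | zero  | ρ , ρ≤  , e = suc ρ , s≤s ρ≤ , cong suc e
... | c ∷ cs | suc β | ρ , ρ≤  , e = ρ , ρ≤ , cong suc e

charSeq-segments : ∀ w {c₀ cs} → segments w ≡ c₀ ∷ cs → charSeq w ≡ addLast c₀ cs
charSeq-segments w eq with segments w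
charSeq-segments w refl | _ = refl

addLast-length : ∀ c cs → length (addLast c cs) ≡ length cs
addLast-length c []           = refl
addLast-length c (y ∷ [])     = refl
addLast-length c (y ∷ z ∷ ys) = cong suc (addLast-length c (z ∷ ys))

addLast-sum : ∀ c cs → 0 < length cs → sum (addLast c cs) ≡ c + sum cs
addLast-sum c (y ∷ [])     _ = regroup y c
  where
  regroup : ∀ y c → y + c + 0 ≡ c + (y + 0)
  regroup = solve-∀
addLast-sum c (y ∷ z ∷ ys) _ =
  trans (cong (y +_) (addLast-sum c (z ∷ ys) z<s)) (x+[y+z]≡y+[x+z] y c _)
  where
  x+[y+z]≡y+[x+z] : ∀ x y z → x + (y + z) ≡ y + (x + z)
  x+[y+z]≡y+[x+z] = solve-∀

addLast-dominates : ∀ c cs i → lookupℕ cs i ≤ lookupℕ (addLast c cs) i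
addLast-dominates c []           i       = z≤n
addLast-dominates c (y ∷ [])     zero    = m≤m+n y c
addLast-dominates c (y ∷ [])     (suc i) = z≤n
addLast-dominates c (y ∷ z ∷ ys) zero    = ≤-refl
addLast-dominates c (y ∷ z ∷ ys) (suc i) = addLast-dominates c (z ∷ ys) i

addLast-agrees : ∀ c cs i → suc i < length cs → lookupℕ (addLast c cs) i ≡ lookupℕ cs i
addLast-agrees c (y ∷ [])     i       (s<s ())
addLast-agrees c (y ∷ z ∷ ys) zero    _         = refl
addLast-agrees c (y ∷ z ∷ ys) (suc i) (s<s lt) = addLast-agrees c (z ∷ ys) i lt

addLast-prefix : ∀ c cs j → j < length cs →
  c + prefixSum (lookupℕ (addLast c cs)) j ≡ prefixSum (lookupℕ (c ∷ cs)) (suc j)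
addLast-prefix c cs j j<len = cong (c +_) (prefixSum-cong _ _ j
  (λ i i<j → addLast-agrees c cs i (≤-<-trans i<j j<len)))

addLast-prefix-≥ : ∀ c cs j →
  prefixSum (lookupℕ (c ∷ cs)) (suc j) ≤ c + prefixSum (lookupℕ (addLast c cs)) j
addLast-prefix-≥ c cs j = +-monoʳ-≤ c (prefixSum-mono _ _ j (addLast-dominates c cs))

addLast-total : ∀ c cs → 0 < length cs →
  prefixSum (lookupℕ (addLast c cs)) (length cs) ≡ c + sum cs
addLast-total c cs 0<len = begin
  prefixSum (lookupℕ (addLast c cs)) (length cs)
    ≡⟨ cong (prefixSum (lookupℕ (addLast c cs))) (sym (addLast-length c cs)) ⟩
  prefixSum (lookupℕ (addLast c cs)) (length (addLast c cs))
    ≡⟨ prefixSum-lookup (addLast c cs) ⟩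
  sum (addLast c cs)
    ≡⟨ addLast-sum c cs 0<len ⟩
  c + sum cs ∎
  where open ≡-Reasoning

blockSum-+ : ∀ w b i k l → blockSum w b i (k + l) ≡ blockSum w b i k + blockSum w b (k + i) l
blockSum-+ w b i zero    l = refl
blockSum-+ w b i (suc k) l = trans
  (cong (xAt w b i +_) (trans (blockSum-+ w b (suc i) k l)
    (cong (λ z → blockSum w b (suc i) k + blockSum w b z l) (+-suc k i))))
  (sym (+-assoc (xAt w b i) _ _))

blockSum-prefixSum : ∀ w b i k → blockSum w b i k ≡ prefixSum (λ t → xAt w b (t + i)) k
blockSum-prefixSum w b i zero    = refl
blockSum-prefixSum w b i (suc k) = cong (xAt w b i +_) (trans (blockSum-prefixSum w b (suc i) k)
  (prefixSum-cong _ _ k (λ t _ → cong (xAt w b) (+-suc t i))))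

blockSum-initial : ∀ w b′ j → j ≤ suc b′ →
  blockSum w (suc b′) 0 j ≡ prefixSum (lookupℕ (charSeq w)) j
blockSum-initial w b′ j j≤b = trans (blockSum-prefixSum w (suc b′) 0 j)
  (prefixSum-cong _ _ j (λ t t<j → cong (lookupℕ (charSeq w))
    (trans (cong (_% suc b′) (+-identityʳ t)) (m<n⇒m%n≡m (<-≤-trans t<j j≤b)))))

blockSum-mod : ∀ w b′ i k → blockSum w (suc b′) (i % suc b′) k ≡ blockSum w (suc b′) i k
blockSum-mod w b′ i k = trans (blockSum-prefixSum w b (i % b) k)
  (trans (prefixSum-cong _ _ k sameIndex) (sym (blockSum-prefixSum w b i k)))
  where
  b : ℕ
  b = suc b′
  sameIndex : ∀ t → t < k → xAt w b (t + i % b) ≡ xAt w b (t + i)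
  sameIndex t _ = cong (lookupℕ (charSeq w)) (trans (%-distribˡ-+ t (i % b) b)
    (trans (cong (λ z → (t % b + z) % b) (m%n%n≡m%n i b)) (sym (%-distribˡ-+ t i b))))

blockSum-rotate : ∀ w b′ i → blockSum w (suc b′) i (suc b′) ≡ blockSum w (suc b′) 0 (suc b′)
blockSum-rotate w b′ zero    = refl
blockSum-rotate w b′ (suc i) = trans step (blockSum-rotate w b′ i)
  where
  b : ℕ
  b = suc b′
  periodic : xAt w b (b + i) ≡ xAt w b i
  periodic = cong (lookupℕ (charSeq w)) (trans (cong (_% b) (+-comm b i))
    (trans (cong (λ z → (i + z) % b) (sym (*-identityˡ b))) ([m+kn]%n≡m%n i 1 b)))
  -- both sides are the block of length b + 1 at i, minus x_i
  step : blockSum w b (suc i) b ≡ blockSum w b i b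
  step = +-cancelˡ-≡ (xAt w b i) _ _ (begin
    xAt w b i + blockSum w b (suc i) b     ≡⟨ cong (blockSum w b i) (+-comm 1 b) ⟩
    blockSum w b i (b + 1)                 ≡⟨ blockSum-+ w b i b 1 ⟩
    blockSum w b i b + (xAt w b (b + i) + 0) ≡⟨ cong (λ z → blockSum w b i b + z) (trans (+-identityʳ _) periodic) ⟩
    blockSum w b i b + xAt w b i           ≡⟨ +-comm _ (xAt w b i) ⟩
    xAt w b i + blockSum w b i b           ∎)
    where open ≡-Reasoning

someHalfShort : ∀ B K K′ → K + K′ ≡ B → K ≤ suc (B / 2) ⊎ K′ ≤ suc (B / 2)
someHalfShort B K K′ e with K ≤? suc (B / 2) | K′ ≤? suc (B / 2)
... | yes K≤ | _      = inj₁ K≤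
... | no _   | yes K′≤ = inj₂ K′≤
... | no K≰  | no K′≰  = ⊥-elim (<-irrefl refl (begin-strict
  B                           ≡⟨ m≡m%n+[m/n]*n B 2 ⟩
  B % 2 + h * 2               <⟨ +-monoˡ-< (h * 2) (m%n<n B 2) ⟩
  2 + h * 2                   ≤⟨ m≤m+n (2 + h * 2) 2 ⟩
  2 + h * 2 + 2               ≡⟨ regroup h ⟩
  suc (suc h) + suc (suc h)   ≤⟨ +-mono-≤ (≰⇒> K≰) (≰⇒> K′≰) ⟩
  K + K′                      ≡⟨ e ⟩
  B                           ∎))
  where
  open ≤-Reasoning
  h : ℕ
  h = B / 2
  regroup : ∀ h → 2 + h * 2 + 2 ≡ suc (suc h) + suc (suc h)
  regroup = solve-∀

module Regularity (a b′ : ℕ) (w : List Bead) (reg : Regular a (suc b′) w)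
                  (total : blockSum w (suc b′) 0 (suc b′) ≡ a) where

  b : ℕ
  b = suc b′

  -- Regularity constrains blocks of length ≤ 1 + ⌊b/2⌋ starting at i < b;
  -- by periodicity it holds for such blocks starting anywhere.
  shortBlock : ∀ i K → K ≤ suc (b / 2) → Near b (a * K) (b * blockSum w b i K)
  shortBlock i zero    _  = Near-zero a b z<s
  shortBlock i (suc k) K≤ = subst (λ s → Near b (a * suc k) (b * s)) (blockSum-mod w b′ i (suc k))
    (reg (i % b) (suc k) (m%n<n i b) (s≤s z≤n) K≤)

  -- A block and its complement in a full period have complementary lengths
  -- and sums, so regularity extends to all blocks of length ≤ b.
  anyBlock : ∀ i K → K ≤ b → Near b (a * K) (b * blockSum w b i K)
  anyBlock i K K≤b = byShortHalf (someHalfShort b K K′ KK′)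
    where
    K′ : ℕ
    K′ = b ∸ K
    KK′ : K + K′ ≡ b
    KK′ = m+[n∸m]≡n K≤b
    S S′ : ℕ
    S = blockSum w b i K
    S′ = blockSum w b (K + i) K′
    lengths : a * K′ + a * K ≡ a * b
    lengths = trans (sym (*-distribˡ-+ a K′ K)) (cong (a *_) (trans (+-comm K′ K) KK′))
    sums : S + S′ ≡ a
    sums = trans (sym (blockSum-+ w b i K K′))
      (trans (cong (blockSum w b i) KK′) (trans (blockSum-rotate w b′ i) total))
    totals : a * K′ + a * K ≡ b * S′ + b * S
    totals = trans lengths (trans (*-comm a b) (trans (cong (b *_) (sym sums))
      (trans (*-distribˡ-+ b S S′) (+-comm (b * S) (b * S′)))))
    byShortHalf : K ≤ suc (b / 2) ⊎ K′ ≤ suc (b / 2) → Near b (a * K) (b * S)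
    byShortHalf (inj₁ short) = shortBlock i K short
    byShortHalf (inj₂ short) = Near-complement totals (shortBlock (K + i) K′ short)

  X : ℕ → ℕ
  X = blockSum w b 0

  prefixBalance-≤ : ∀ p q → p ≤ q → q ≤ b → Near b (b * X p + a * q) (b * X q + a * p)
  prefixBalance-≤ p q p≤q q≤b = subst₂ (Near b) lhs rhs (Near-shift (b * X p + a * p) block)
    where
    K S : ℕ
    K = q ∸ p
    S = blockSum w b (p + 0) K
    q≡p+K : p + K ≡ q
    q≡p+K = m+[n∸m]≡n p≤q
    block : Near b (a * K) (b * S)
    block = anyBlock (p + 0) K (≤-trans (m∸n≤m q p) q≤b)
    lhs : b * X p + a * p + a * K ≡ b * X p + a * q
    lhs = trans (+-assoc (b * X p) _ _)
      (cong (b * X p +_) (trans (sym (*-distribˡ-+ a p K)) (cong (a *_) q≡p+K)))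
    rhs : b * X p + a * p + b * S ≡ b * X q + a * p
    rhs = trans (regroup b a (X p) S p)
      (cong (λ z → b * z + a * p) (trans (sym (blockSum-+ w b 0 p K)) (cong X q≡p+K)))
      where
      regroup : ∀ b a x s p → b * x + a * p + b * s ≡ b * (x + s) + a * p
      regroup = solve-∀

  prefixBalance : ∀ p q → p ≤ b → q ≤ b → Near b (b * X p + a * q) (b * X q + a * p)
  prefixBalance p q p≤b q≤b with ≤-total p q
  ... | inj₁ p≤q = prefixBalance-≤ p q p≤q q≤b
  ... | inj₂ q≤p = Near-sym (prefixBalance-≤ q p q≤p p≤b)

combineBounds : ∀ b a c x₁ x R₁ R₂ β₁ β₂ j → R₁ ≤ c + x₁ →
  b * (c + x) + a * β₂ ≤ b * R₂ + a * suc j → b * x₁ + a * j < b * x + a * β₁ + b →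
  b * R₁ + a * β₂ < b * R₂ + a * β₁ + (a + b)
combineBounds b a c x₁ x R₁ R₂ β₁ β₂ j R₁≤ low bal = +-cancelʳ-< (b * c + b * x + b * x₁ + a * j) _ _
  (subst₂ _<_ (left b a c x₁ x R₁ β₂ j) (right b a c x₁ x R₂ β₁ j)
    (+-mono-≤-< (+-mono-≤ (*-monoʳ-≤ b R₁≤) low) bal))
  where
  left : ∀ b a c x₁ x R₁ β₂ j → b * R₁ + (b * (c + x) + a * β₂) + (b * x₁ + a * j)
    ≡ b * R₁ + a * β₂ + (b * c + b * x + b * x₁ + a * j)
  left = solve-∀
  right : ∀ b a c x₁ x R₂ β₁ j → b * (c + x₁) + (b * R₂ + a * suc j) + (b * x + a * β₁ + b)
    ≡ b * R₂ + a * β₁ + (a + b) + (b * c + b * x + b * x₁ + a * j)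
  right = solve-∀

module Discrepancy (a b′ : ℕ) (w : List Bead) (reds : countRed w ≡ a)
                   (blacks : countBlack w ≡ suc b′) (reg : Regular a (suc b′) w) where

  b : ℕ
  b = suc b′

  c₀ : ℕ
  c₀ = proj₁ (segments-shape w)

  cs : List ℕ
  cs = proj₁ (proj₂ (segments-shape w))

  runs : segments w ≡ c₀ ∷ cs
  runs = proj₁ (proj₂ (proj₂ (segments-shape w)))

  cs-length : length cs ≡ b
  cs-length = trans (proj₂ (proj₂ (proj₂ (segments-shape w)))) blacks

  -- P β: number of red beads before the β-th black bead.
  P : ℕ → ℕ
  P = prefixSum (lookupℕ (segments w))

  P-runs : ∀ k → P k ≡ prefixSum (lookupℕ (c₀ ∷ cs)) k
  P-runs k = cong (λ s → prefixSum (lookupℕ s) k) runs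

  X-runs : ∀ j → j ≤ b → blockSum w b 0 j ≡ prefixSum (lookupℕ (addLast c₀ cs)) j
  X-runs j j≤b = trans (blockSum-initial w b′ j j≤b)
    (cong (λ xs → prefixSum (lookupℕ xs) j) (charSeq-segments w runs))

  total : blockSum w b 0 b ≡ a
  total = begin
    blockSum w b 0 b                               ≡⟨ X-runs b ≤-refl ⟩
    prefixSum (lookupℕ (addLast c₀ cs)) b          ≡⟨ cong (prefixSum (lookupℕ (addLast c₀ cs))) (sym cs-length) ⟩
    prefixSum (lookupℕ (addLast c₀ cs)) (length cs) ≡⟨ addLast-total c₀ cs (subst (0 <_) (sym cs-length) z<s) ⟩
    sum (c₀ ∷ cs)                                  ≡⟨ cong sum (sym runs) ⟩
    sum (segments w)                               ≡⟨ segments-sum w ⟩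
    countRed w                                     ≡⟨ reds ⟩
    a                                              ∎
    where open ≡-Reasoning

  open Regularity a b′ w reg total using (X; prefixBalance)

  all-reds : P (suc b) ≡ a
  all-reds = begin
    P (suc b)                                 ≡⟨ P-runs (suc b) ⟩
    prefixSum (lookupℕ (c₀ ∷ cs)) (suc b)     ≡⟨ cong (λ k → prefixSum (lookupℕ (c₀ ∷ cs)) (suc k)) (sym cs-length) ⟩
    prefixSum (lookupℕ (c₀ ∷ cs)) (length (c₀ ∷ cs)) ≡⟨ prefixSum-lookup (c₀ ∷ cs) ⟩
    sum (c₀ ∷ cs)                             ≡⟨ cong sum (sym runs) ⟩
    sum (segments w)                          ≡⟨ trans (segments-sum w) reds ⟩
    a                                         ∎
    where open ≡-Reasoning

  runs-below : ∀ j → j < b → c₀ + X j ≡ P (suc j)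
  runs-below j j<b = trans (cong (c₀ +_) (X-runs j (<⇒≤ j<b)))
    (trans (addLast-prefix c₀ cs j (subst (j <_) (sym cs-length) j<b)) (sym (P-runs (suc j))))

  runs-upTo : ∀ β → β ≤ b → P (suc β) ≤ c₀ + X β
  runs-upTo β β≤b = subst₂ _≤_ (sym (P-runs (suc β))) (cong (c₀ +_) (sym (X-runs β β≤b)))
    (addLast-prefix-≥ c₀ cs β)

  upper : ∀ β ρ → β ≤ b → ρ ≤ lookupℕ (segments w) β → P β + ρ ≤ c₀ + X β
  upper β ρ β≤b ρ≤ = ≤-trans (+-monoʳ-≤ (P β) ρ≤)
    (≤-trans (≤-reflexive (sym (prefixSum-snoc _ β))) (runs-upTo β β≤b))

  lower : ∀ β → β ≤ b → Σ ℕ λ j → j ≤ b × b * (c₀ + X j) + a * β ≤ b * P β + a * suc j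
  lower zero    _   = b′ , n≤1+n b′ , (begin
    b * (c₀ + X b′) + a * 0  ≡⟨ cong (b * (c₀ + X b′) +_) (*-zeroʳ a) ⟩
    b * (c₀ + X b′) + 0      ≡⟨ +-identityʳ _ ⟩
    b * (c₀ + X b′)          ≤⟨ *-monoʳ-≤ b below-all ⟩
    b * a                    ≡⟨ *-comm b a ⟩
    a * b                    ≡⟨ sym (cong (_+ a * b) (*-zeroʳ b)) ⟩
    b * 0 + a * b            ∎)
    where
    open ≤-Reasoning
    below-all : c₀ + X b′ ≤ a
    below-all = subst₂ _≤_ (sym (runs-below b′ ≤-refl)) all-reds (prefixSum-monoʳ (lookupℕ (segments w)) (n≤1+n b))
  lower (suc β) β<b = β , <⇒≤ β<b ,
    ≤-reflexive (cong (λ r → b * r + a * suc β) (runs-below β β<b))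

  blacksIn : ∀ t → countBlack (take t w) ≤ b
  blacksIn t = ≤-trans (countBlack-take t w) (≤-reflexive blacks)

  -- Compare the upper bound for one prefix with the lower bound for the
  -- other, through the balance of X at β₁ and j.
  spread : ∀ t₁ t₂ → b * countRed (take t₁ w) + a * countBlack (take t₂ w)
    < b * countRed (take t₂ w) + a * countBlack (take t₁ w) + (a + b)
  spread t₁ t₂ with prefixReds w t₁ | prefixReds w t₂ | lower (countBlack (take t₂ w)) (blacksIn t₂)
  ... | ρ₁ , ρ₁≤ , R₁≡ | ρ₂ , _ , R₂≡ | j , j≤b , low = combineBounds b a c₀ (X β₁) (X j) R₁ R₂ β₁ β₂ j
    (subst (_≤ c₀ + X β₁) (sym R₁≡) (upper β₁ ρ₁ (blacksIn t₁) ρ₁≤))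
    (≤-trans low (+-monoˡ-≤ (a * suc j) (*-monoʳ-≤ b (subst (P β₂ ≤_) (sym R₂≡) (m≤m+n _ ρ₂)))))
    (proj₁ (prefixBalance β₁ j (blacksIn t₁) j≤b))
    where
    β₁ β₂ R₁ R₂ : ℕ
    β₁ = countBlack (take t₁ w)
    β₂ = countBlack (take t₂ w)
    R₁ = countRed (take t₁ w)
    R₂ = countRed (take t₂ w)

  prefixWeightsNear : ∀ t₁ t₂ → Near (a + b)
    (b * countRed (take t₁ w) + a * countBlack (take t₂ w))
    (b * countRed (take t₂ w) + a * countBlack (take t₁ w))
  prefixWeightsNear t₁ t₂ = spread t₁ t₂ , spread t₂ t₁

sameVertex⇒relation : ∀ n′ μ a b w j₁ j₂ t₁ t₂ → suc n′ ≡ a * suc μ + b →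
  cycleVertex (suc n′) (suc μ) w (j₁ * μ) t₁ ≡ cycleVertex (suc n′) (suc μ) w (j₂ * μ) t₂ →
  Σ ℕ λ G₀ → Σ ℕ λ G₁ →
    j₂ * (a + b) + (b * countRed (take t₂ w) + a * countBlack (take t₁ w)) + suc n′ * G₀ ≡
    suc n′ * G₁ + (b * countRed (take t₁ w) + a * countBlack (take t₂ w) + j₁ * (a + b))
sameVertex⇒relation n′ μ a b w j₁ j₂ t₁ t₂ n≡ same =
  G₀ , G₁ , subst (λ N → x + N * G₀ ≡ N * G₁ + y) (sym n≡) relation
  where
  n β₁ β₂ R₁ R₂ A₁ A₂ G₀ G₁ x y : ℕ
  n = suc n′
  β₁ = countBlack (take t₁ w)
  β₂ = countBlack (take t₂ w)
  R₁ = countRed (take t₁ w)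
  R₂ = countRed (take t₂ w)
  A₁ = j₁ * μ + (β₁ + suc μ * R₁)
  A₂ = j₂ * μ + (β₂ + suc μ * R₂)
  x = j₂ * (a + b) + (b * R₂ + a * β₁)
  y = b * R₁ + a * β₂ + j₁ * (a + b)
  residues : A₁ % n ≡ A₂ % n
  residues = subst₂ (λ u v → (j₁ * μ + u) % n ≡ (j₂ * μ + v) % n)
    (prefixLen-colours (suc μ) (take t₁ w)) (prefixLen-colours (suc μ) (take t₂ w)) same
  G₀ = j₁ + R₁ + A₂ / n * a
  G₁ = j₂ + R₂ + A₁ / n * a
  relation : x + (a * suc μ + b) * G₀ ≡ (a * suc μ + b) * G₁ + y
  relation = scaledCongruence μ a b j₁ j₂ β₁ β₂ R₁ R₂ (A₁ / n) (A₂ / n)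
    (subst (λ N → A₁ + A₂ / n * N ≡ A₂ + A₁ / n * N) n≡ (sameResidue A₁ A₂ n residues))

theorem7 : (n m a b : ℕ) → 0 < n → 0 < m →
    n ≡ a * m + b → 0 < a → 0 < b → b < m →
    (w : List Bead) → length w ≡ a + b → countRed w ≡ a → Regular a b w →
    (j₁ j₂ : ℕ) → j₁ < j₂ → j₂ < n div′ (a + b) →
    (t₁ t₂ : ℕ) → t₁ < a + b → t₂ < a + b →
    cycleVertex n m w (j₁ * (m ∸ 1)) t₁ ≢ cycleVertex n m w (j₂ * (m ∸ 1)) t₂
theorem7 (suc n′) (suc μ) (suc a′) (suc b′) _ _ n≡ _ _ _ w len reds reg j₁ j₂ j₁<j₂ j₂<k t₁ t₂ _ _ same
  with sameVertex⇒relation n′ μ (suc a′) (suc b′) w j₁ j₂ t₁ t₂ n≡ same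
... | G₀ , G₁ , relation = window (suc n′) x y G₀ G₁ (proj₁ between) (proj₂ between) relation
  where
  a b x y : ℕ
  a = suc a′
  b = suc b′
  blacks : countBlack w ≡ b
  blacks = +-cancelˡ-≡ a _ _ (trans (sym (trans (length-colours w) (cong (_+ countBlack w) reds))) len)
  x = j₂ * (a + b) + (b * countRed (take t₂ w) + a * countBlack (take t₁ w))
  y = b * countRed (take t₁ w) + a * countBlack (take t₂ w) + j₁ * (a + b)
  fits : suc j₂ * (a + b) ≤ suc n′
  fits = ≤-trans (*-monoˡ-≤ (a + b) j₂<k) (m/n*n≤m (suc n′) (a + b))
  between : y < x × x < y + suc n′
  between = shiftedWeights (Discrepancy.prefixWeightsNear a b′ w reds blacks reg t₁ t₂) j₁<j₂ fits
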